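{- Whenever $(\Gamma_1,\dots,\Gamma_n)$ is an element, there exists $\Gamma_{n+1}\subseteq Form$ such that $(\Gamma_1,\dots,\Gamma_n,\Gamma_{n+1})$ is also an element.
   Context: Fix a finite nonempty set $Ag$ and countably infinite disjoint sets $PVar$, $PConst$, $Var$. $Pol$: $t ::= x \mid c \mid s+t \mid s\times t \mid\ !t$. $Form$: $A ::= p \mid A\wedge B \mid \neg A \mid [j]A \mid \Box A \mid t{:}A \mid KA \mid Et$; $\Diamond=\neg\Box\neg$. $\Sigma$: axioms (A0) propositional tautologies; (A1) S5 for $\Box$ and each $[j]$; (A2) $\Box A\to[j]A$; (A3) $(\Diamond[j_1]A_1\wedge\dots\wedge\Diamond[j_n]A_n)\to\Diamond([j_1]A_1\wedge\dots\wedge[j_n]A_n)$, $j_i$ distinct; (A4) $s{:}(A\to B)\to(t{:}A\to(s\times t){:}B)$; (A5) $t{:}A\to(!t{:}(t{:}A)\wedge KA)$; (A6) $(s{:}A\vee t{:}A)\to(s+t){:}A$; (A7) S4 for $K$; (A8) $KA\to\Box K\Box A$; (A9) $\Box Et\to K\Box Et$; rules (R1) modus ponens; (R2) $A/KA$; (R3) $c{:}A$ for $A$ an instance of (A0)–(A9), $c\in PConst$; (R4) from $KA\to(\neg\Box Et_1\vee\dots\vee\neg\Box Et_n)$ infer $KA\to(\neg Et_1\vee\dots\vee\neg Et_n)$. A set $\Gamma$ is inconsistent iff $\vdash(A_1\wedge\dots\wedge A_n)\to\bot$ for some $A_i\in\Gamma$; maxiconsistent iff consistent with no consistent proper extension.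 An element is a finite sequence $(\Gamma_1,\dots,\Gamma_n)$, $n\ge1$, of maxiconsistent sets such that for every $k<n$: for all $A$, $KA\in\Gamma_k$ implies $KA\in\Gamma_{k+1}$; and for all $t\in Pol$, $Et\in\Gamma_k$ implies $\Box Et\in\Gamma_{k+1}$. -}

module Defs where

open import Data.Nat using (ℕ; _≤_)
open import Data.Fin using (Fin)
open import Data.Bool using (Bool; true; false; _∧_; not)
open import Data.List using (List; []; _∷_; map; length)
open import Data.List.Relation.Unary.All using (All)
open import Data.List.Relation.Unary.Unique.Propositional using (Unique)
open import Data.List.Relation.Unary.Linked using (Linked)
open import Data.Product using (_×_; _,_; proj₁; ∃)
open import Relation.Binary.PropositionalEquality using (_≡_)
open import Relation.Nullary using (¬_)
open import Relation.Unary using (Pred; _⊆_)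
open import Level using (0ℓ)

-- Agents: Ag = Fin (suc m), an arbitrary finite nonempty set (up to bijection).
-- PVar, PConst, Var: three disjoint copies of ℕ (distinct constructors).

Ag : ℕ → Set
Ag m = Fin (ℕ.suc m)

data Pol : Set where
  pvar  : ℕ → Pol
  pconst : ℕ → Pol
  _⊕_   : Pol → Pol → Pol
  _⊗_   : Pol → Pol → Pol
  !_    : Pol → Pol

data Form (m : ℕ) : Set where
  var  : ℕ → Form m
  _∧'_ : Form m → Form m → Form m
  ¬'_  : Form m → Form m
  [_]_ : Ag m → Form m → Form m
  □_   : Form m → Form m
  _∶_  : Pol → Form m → Form m
  K_   : Form m → Form m
  E_   : Pol → Form m

infixr 6 _∧'_
infix 9 ¬'_ □_ K_ [_]_ _∶_

module _ {m : ℕ} where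
  infixr 4 _⇒_
  infixr 5 _∨'_
  infix 9 ◇_

  ◇_ : Form m → Form m
  ◇ A = ¬' (□ (¬' A))

  _⇒_ : Form m → Form m → Form m
  A ⇒ B = ¬' (A ∧' ¬' B)

  _∨'_ : Form m → Form m → Form m
  A ∨' B = ¬' (¬' A ∧' ¬' B)

  ⊥' : Form m
  ⊥' = var 0 ∧' ¬' (var 0)

  ⊤' : Form m
  ⊤' = ¬' ⊥'

  ⋀ : List (Form m) → Form m
  ⋀ [] = ⊤'
  ⋀ (A ∷ As) = A ∧' ⋀ As

  ⋁ : List (Form m) → Form m
  ⋁ [] = ⊥'
  ⋁ (A ∷ As) = A ∨' ⋁ As

  -- propositional evaluation: non-Boolean subformulas are treated as atoms
  eval : (Form m → Bool) → Form m → Bool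
  eval v (A ∧' B) = eval v A ∧ eval v B
  eval v (¬' A)   = not (eval v A)
  eval v A        = v A

  Taut : Form m → Set
  Taut A = ∀ (v : Form m → Bool) → eval v A ≡ true

  data Axiom : Form m → Set where
    A0  : ∀ {A} → Taut A → Axiom A
    A1□K : ∀ {A B} → Axiom (□ (A ⇒ B) ⇒ (□ A ⇒ □ B))
    A1□T : ∀ {A} → Axiom (□ A ⇒ A)
    A1□5 : ∀ {A} → Axiom (◇ A ⇒ □ (◇ A))
    A1jK : ∀ {j A B} → Axiom ([ j ] (A ⇒ B) ⇒ ([ j ] A ⇒ [ j ] B))
    A1jT : ∀ {j A} → Axiom ([ j ] A ⇒ A)
    A1j5 : ∀ {j A} → Axiom (¬' ([ j ] (¬' A)) ⇒ [ j ] (¬' ([ j ] (¬' A))))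
    A2  : ∀ {j A} → Axiom (□ A ⇒ [ j ] A)
    A3  : ∀ (js : List (Ag m × Form m)) → Unique (map proj₁ js) →
          Axiom (⋀ (map (λ { (j , A) → ◇ ([ j ] A) }) js)
                 ⇒ ◇ (⋀ (map (λ { (j , A) → [ j ] A }) js)))
    A4  : ∀ {s t A B} → Axiom ((s ∶ (A ⇒ B)) ⇒ ((t ∶ A) ⇒ ((s ⊗ t) ∶ B)))
    A5  : ∀ {t A} → Axiom ((t ∶ A) ⇒ ((! t) ∶ (t ∶ A) ∧' K A))
    A6  : ∀ {s t A} → Axiom (((s ∶ A) ∨' (t ∶ A)) ⇒ ((s ⊕ t) ∶ A))
    A7K : ∀ {A B} → Axiom (K (A ⇒ B) ⇒ (K A ⇒ K B))
    A7T : ∀ {A} → Axiom (K A ⇒ A)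
    A74 : ∀ {A} → Axiom (K A ⇒ K (K A))
    A8  : ∀ {A} → Axiom (K A ⇒ □ (K (□ A)))
    A9  : ∀ {t} → Axiom (□ (E t) ⇒ K (□ (E t)))

  infix 2 ⊢_
  data ⊢_ : Form m → Set where
    ax  : ∀ {A} → Axiom A → ⊢ A
    R1  : ∀ {A B} → ⊢ (A ⇒ B) → ⊢ A → ⊢ B
    R2  : ∀ {A} → ⊢ A → ⊢ K A
    R3  : ∀ {A} (c : ℕ) → Axiom A → ⊢ (pconst c ∶ A)
    R4  : ∀ {A} (ts : List Pol) →
          ⊢ (K A ⇒ ⋁ (map (λ t → ¬' (□ (E t))) ts)) →
          ⊢ (K A ⇒ ⋁ (map (λ t → ¬' (E t)) ts))

  FSet : Set₁
  FSet = Pred (Form m) 0ℓ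

  Inconsistent : FSet → Set
  Inconsistent Γ = ∃ λ (As : List (Form m)) → All Γ As × (⊢ (⋀ As ⇒ ⊥'))

  Consistent : FSet → Set
  Consistent Γ = ¬ Inconsistent Γ

  ProperExt : FSet → FSet → Set
  ProperExt Γ Δ = Γ ⊆ Δ × ∃ λ A → Δ A × ¬ Γ A

  Maxiconsistent : FSet → Set₁
  Maxiconsistent Γ = Consistent Γ × (∀ (Δ : FSet) → ProperExt Γ Δ → ¬ Consistent Δ)

  Step : FSet → FSet → Set
  Step Γ Γ' = (∀ A → Γ (K A) → Γ' (K A)) × (∀ t → Γ (E t) → Γ' (□ (E t)))

  Element : List FSet → Set₁
  Element Γs = 1 ≤ length Γs × All Maxiconsistent Γs × Linked Step Γs

-- The successor Γₙ₊₁ is a maximal consistent extension of the set of formulas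
-- it is forced to contain, {K A ∣ K A ∈ Γₙ} ∪ {□ E t ∣ E t ∈ Γₙ}.  That set is
-- consistent: a refutation of finitely many of its members gives
-- ⊢ ⋀ K Aᵢ ⇒ ⋁ ¬ □ E tⱼ, and after merging the K Aᵢ into K (⋀ Aᵢ) this is
-- exactly the premise of rule R4, whose conclusion refutes the subset
-- {K Aᵢ} ∪ {E tⱼ} of the consistent set Γₙ.  The maximal consistent extension
-- is Lindenbaum's, built along an injective coding of formulas into ℕ.

module Submission where

open import Defs
open import Data.Bool using (Bool; true; false; _∧_; not)
open import Data.Bool.Properties using () renaming (_≟_ to _≟ᵇ_)
open import Data.Empty using (⊥-elim)
open import Data.Fin using (Fin; toℕ)
open import Data.List using (List; []; _∷_; _++_; [_]; map; length; last)
open import Data.List.Properties using (length-++-≤ˡ)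
open import Data.List.Relation.Unary.All using (All; []; _∷_)
import Data.List.Relation.Unary.All as All
import Data.List.Relation.Unary.All.Properties as All
open import Data.List.Relation.Unary.Any using (Any; here; there; satisfied)
import Data.List.Relation.Unary.Any as Any
import Data.List.Relation.Unary.Any.Properties as Any
open import Data.List.Relation.Unary.Linked using ([-])
import Data.List.Relation.Unary.Linked.Properties as Linked
open import Data.Maybe using (Maybe; just; nothing; zipWith)
import Data.Maybe as Maybe
open import Data.Maybe.Properties using (just-injective)
open import Data.Maybe.Relation.Binary.Connected using (Connected; just)
import Data.Maybe.Relation.Unary.Any as MaybeAny
open import Data.Nat using (ℕ; zero; suc; _≤_; s≤s; z≤n; _⊔_; _≤′_; ≤′-refl; ≤′-step)
open import Data.Nat.Binary using (ℕᵇ; 2[1+_]; 1+[2_])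
import Data.Nat.Binary as ℕᵇ
open import Data.Nat.Binary.Properties using (2[1+_]-injective; 1+[2_]-injective)
import Data.Nat.Binary.Properties as ℕᵇ
open import Data.Nat.Properties using (≤-trans; ≤⇒≤′; m≤m⊔n; m≤n⊔m)
open import Data.Product using (Σ; Σ-syntax; ∃; _×_; _,_; proj₁; proj₂)
open import Data.Sum using (_⊎_; inj₁; inj₂)
import Data.Sum as Sum
open import Function using (_∘_)
open import Function.Definitions using (Injective)
open import Relation.Binary.PropositionalEquality using (_≡_; refl; sym; trans; cong; cong₂; module ≡-Reasoning)
open import Relation.Nullary using (¬_; Dec; yes; no)
open import Relation.Nullary.Decidable using (decidable-stable)
open import Relation.Unary using (Pred; _⊆_; _∪_; ｛_｝; ⋃)

All∪⇒All⊎Any : ∀ {a p q} {A : Set a} {P : Pred A p} {Q : Pred A q} {xs} →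
               All (P ∪ Q) xs → All P xs ⊎ Any Q xs
All∪⇒All⊎Any []             = inj₁ []
All∪⇒All⊎Any (inj₁ p ∷ pqs) = Sum.map (p ∷_) there (All∪⇒All⊎Any pqs)
All∪⇒All⊎Any (inj₂ q ∷ _)   = inj₂ (here q)

last-satisfies : ∀ {a p} {A : Set a} {P : Pred A p} {xs} →
                 1 ≤ length xs → All P xs → MaybeAny.Any P (last xs)
last-satisfies _ (px ∷ [])         = MaybeAny.just px
last-satisfies _ (_ ∷ pxs@(_ ∷ _)) = last-satisfies (s≤s z≤n) pxs

-- Injective coding of formulas

data Tree : Set where
  leaf : ℕ → Tree
  node : Tree → Tree → Tree

-- ℕᵇ numerals are exactly the finite bit strings (bijective base 2), and
-- serialise prepends a prefix-free code of the tree to such a string.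
unary : ℕ → ℕᵇ → ℕᵇ
unary zero    r = 1+[2 r ]
unary (suc n) r = 2[1+ unary n r ]

serialise : Tree → ℕᵇ → ℕᵇ
serialise (leaf n)   r = 1+[2 unary n r ]
serialise (node s t) r = 2[1+ serialise s (serialise t r) ]

unary-injective : ∀ m n {r r′} → unary m r ≡ unary n r′ → m ≡ n × r ≡ r′
unary-injective zero    zero    eq = refl , 1+[2_]-injective eq
unary-injective (suc m) (suc n) eq with unary-injective m n (2[1+_]-injective eq)
... | refl , r≡r′ = refl , r≡r′

serialise-injective : ∀ s t {r r′} → serialise s r ≡ serialise t r′ → s ≡ t × r ≡ r′
serialise-injective (leaf m) (leaf n) eq with unary-injective m n (1+[2_]-injective eq)
... | refl , r≡r′ = refl , r≡r′
serialise-injective (node s₁ s₂) (node t₁ t₂) eq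
  with serialise-injective s₁ t₁ (2[1+_]-injective eq)
... | refl , eq₂ with serialise-injective s₂ t₂ eq₂
...   | refl , r≡r′ = refl , r≡r′

treeCode : Tree → ℕ
treeCode t = ℕᵇ.toℕ (serialise t ℕᵇ.zero)

treeCode-injective : Injective _≡_ _≡_ treeCode
treeCode-injective {s} {t} eq = proj₁ (serialise-injective s t (ℕᵇ.toℕ-injective eq))

toFin : ∀ {n} → ℕ → Maybe (Fin n)
toFin {zero}  _       = nothing
toFin {suc n} zero    = just Fin.zero
toFin {suc n} (suc k) = Maybe.map Fin.suc (toFin k)

toFin-toℕ : ∀ {n} (i : Fin n) → toFin (toℕ i) ≡ just i
toFin-toℕ Fin.zero    = refl
toFin-toℕ (Fin.suc i) rewrite toFin-toℕ i = refl

polTree : Pol → Tree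
polTree (pvar n)   = node (leaf 0) (leaf n)
polTree (pconst n) = node (leaf 1) (leaf n)
polTree (s ⊕ t)    = node (leaf 2) (node (polTree s) (polTree t))
polTree (s ⊗ t)    = node (leaf 3) (node (polTree s) (polTree t))
polTree (! t)      = node (leaf 4) (polTree t)

decodePol : Tree → Maybe Pol
decodePol (node (leaf 0) (leaf n))   = just (pvar n)
decodePol (node (leaf 1) (leaf n))   = just (pconst n)
decodePol (node (leaf 2) (node a b)) = zipWith _⊕_ (decodePol a) (decodePol b)
decodePol (node (leaf 3) (node a b)) = zipWith _⊗_ (decodePol a) (decodePol b)
decodePol (node (leaf 4) a)          = Maybe.map !_ (decodePol a)
decodePol _                          = nothing

decodePol-polTree : ∀ t → decodePol (polTree t) ≡ just t
decodePol-polTree (pvar n)   = refl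
decodePol-polTree (pconst n) = refl
decodePol-polTree (s ⊕ t) rewrite decodePol-polTree s | decodePol-polTree t = refl
decodePol-polTree (s ⊗ t) rewrite decodePol-polTree s | decodePol-polTree t = refl
decodePol-polTree (! t)   rewrite decodePol-polTree t = refl

module _ {m : ℕ} where

  formTree : Form m → Tree
  formTree (var n)   = node (leaf 0) (leaf n)
  formTree (A ∧' B)  = node (leaf 1) (node (formTree A) (formTree B))
  formTree (¬' A)    = node (leaf 2) (formTree A)
  formTree ([ j ] A) = node (leaf 3) (node (leaf (toℕ j)) (formTree A))
  formTree (□ A)     = node (leaf 4) (formTree A)
  formTree (t ∶ A)   = node (leaf 5) (node (polTree t) (formTree A))
  formTree (K A)     = node (leaf 6) (formTree A)
  formTree (E t)     = node (leaf 7) (polTree t)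

  decodeForm : Tree → Maybe (Form m)
  decodeForm (node (leaf 0) (leaf n))          = just (var n)
  decodeForm (node (leaf 1) (node a b))        = zipWith _∧'_ (decodeForm a) (decodeForm b)
  decodeForm (node (leaf 2) a)                 = Maybe.map ¬'_ (decodeForm a)
  decodeForm (node (leaf 3) (node (leaf k) a)) = zipWith [_]_ (toFin k) (decodeForm a)
  decodeForm (node (leaf 4) a)                 = Maybe.map □_ (decodeForm a)
  decodeForm (node (leaf 5) (node a b))        = zipWith _∶_ (decodePol a) (decodeForm b)
  decodeForm (node (leaf 6) a)                 = Maybe.map K_ (decodeForm a)
  decodeForm (node (leaf 7) a)                 = Maybe.map E_ (decodePol a)
  decodeForm _                                 = nothing

  decodeForm-formTree : ∀ A → decodeForm (formTree A) ≡ just A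
  decodeForm-formTree (var n)   = refl
  decodeForm-formTree (A ∧' B)  rewrite decodeForm-formTree A | decodeForm-formTree B = refl
  decodeForm-formTree (¬' A)    rewrite decodeForm-formTree A = refl
  decodeForm-formTree ([ j ] A) rewrite toFin-toℕ j | decodeForm-formTree A = refl
  decodeForm-formTree (□ A)     rewrite decodeForm-formTree A = refl
  decodeForm-formTree (t ∶ A)   rewrite decodePol-polTree t | decodeForm-formTree A = refl
  decodeForm-formTree (K A)     rewrite decodeForm-formTree A = refl
  decodeForm-formTree (E t)     rewrite decodePol-polTree t = refl

  formTree-injective : Injective _≡_ _≡_ formTree
  formTree-injective {A} {B} eq = just-injective (begin
    just A                  ≡⟨ sym (decodeForm-formTree A) ⟩
    decodeForm (formTree A) ≡⟨ cong decodeForm eq ⟩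
    decodeForm (formTree B) ≡⟨ decodeForm-formTree B ⟩
    just B                  ∎)
    where open ≡-Reasoning

  code : Form m → ℕ
  code = treeCode ∘ formTree

  code-injective : Injective _≡_ _≡_ code
  code-injective = formTree-injective ∘ treeCode-injective

  -- Propositional semantics

  infix 3.5 _⊨_

  -- A record rather than eval v A ≡ true, so that v and A can be inferred
  -- from v ⊨ A.
  record _⊨_ (v : Form m → Bool) (A : Form m) : Set where
    constructor satisfies
    field eval≡true : eval v A ≡ true

  open _⊨_

  _⊨?_ : ∀ v A → Dec (v ⊨ A)
  v ⊨? A with eval v A ≟ᵇ true
  ... | yes a = yes (satisfies a)
  ... | no ¬a = no (¬a ∘ eval≡true)

  module _ {v : Form m → Bool} where

    ⊨-stable : ∀ {A} → ¬ ¬ v ⊨ A → v ⊨ A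
    ⊨-stable {A} = decidable-stable (v ⊨? A)

    ⊨-¬⁺ : ∀ {A} → ¬ v ⊨ A → v ⊨ ¬' A
    ⊨-¬⁺ {A} ¬a with eval v A in eq
    ... | true  = ⊥-elim (¬a (satisfies eq))
    ... | false = satisfies (cong not eq)

    ⊨-¬⁻ : ∀ {A} → v ⊨ ¬' A → ¬ v ⊨ A
    ⊨-¬⁻ {A} (satisfies ¬a) (satisfies a) with eval v A
    ⊨-¬⁻ (satisfies ()) _ | true
    ⊨-¬⁻ _ (satisfies ()) | false

    ⊨-∧⁺ : ∀ {A B} → v ⊨ A → v ⊨ B → v ⊨ A ∧' B
    ⊨-∧⁺ (satisfies a) (satisfies b) = satisfies (cong₂ _∧_ a b)

    ⊨-∧⁻ : ∀ {A B} → v ⊨ A ∧' B → v ⊨ A × v ⊨ B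
    ⊨-∧⁻ {A} {B} (satisfies ab) with eval v A in a | eval v B in b
    ⊨-∧⁻ (satisfies ab) | true  | true  = satisfies a , satisfies b
    ⊨-∧⁻ (satisfies ()) | true  | false
    ⊨-∧⁻ (satisfies ()) | false | _

    ⊨-⇒⁺ : ∀ {A B} → (v ⊨ A → v ⊨ B) → v ⊨ A ⇒ B
    ⊨-⇒⁺ f = ⊨-¬⁺ λ a∧¬b → let a , ¬b = ⊨-∧⁻ a∧¬b in ⊨-¬⁻ ¬b (f a)

    ⊨-⇒⁻ : ∀ {A B} → v ⊨ A ⇒ B → v ⊨ A → v ⊨ B
    ⊨-⇒⁻ a⇒b a = ⊨-stable λ ¬b → ⊨-¬⁻ a⇒b (⊨-∧⁺ a (⊨-¬⁺ ¬b))

    ⊨-∨⁺ : ∀ {A B} → v ⊨ A ⊎ v ⊨ B → v ⊨ A ∨' B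
    ⊨-∨⁺ a⊎b = ⊨-¬⁺ λ ¬a∧¬b → let ¬a , ¬b = ⊨-∧⁻ ¬a∧¬b in Sum.[ ⊨-¬⁻ ¬a , ⊨-¬⁻ ¬b ] a⊎b

    ⊨-∨⁻ : ∀ {A B} → v ⊨ A ∨' B → v ⊨ A ⊎ v ⊨ B
    ⊨-∨⁻ {A} a∨b with v ⊨? A
    ... | yes a = inj₁ a
    ... | no ¬a = inj₂ (⊨-stable λ ¬b → ⊨-¬⁻ a∨b (⊨-∧⁺ (⊨-¬⁺ ¬a) (⊨-¬⁺ ¬b)))

    ⊭⊥' : ¬ v ⊨ ⊥'
    ⊭⊥' p∧¬p = let p , ¬p = ⊨-∧⁻ p∧¬p in ⊨-¬⁻ ¬p p

    ⊨⊤' : v ⊨ ⊤'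
    ⊨⊤' = ⊨-¬⁺ ⊭⊥'

    ⊨-⋀⁺ : ∀ {As} → All (v ⊨_) As → v ⊨ ⋀ As
    ⊨-⋀⁺ []       = ⊨⊤'
    ⊨-⋀⁺ (a ∷ as) = ⊨-∧⁺ a (⊨-⋀⁺ as)

    ⊨-⋀⁻ : ∀ {As} → v ⊨ ⋀ As → All (v ⊨_) As
    ⊨-⋀⁻ {[]}     _ = []
    ⊨-⋀⁻ {A ∷ As} h = let a , as = ⊨-∧⁻ h in a ∷ ⊨-⋀⁻ as

    ⊨-⋁⁺ : ∀ {As} → Any (v ⊨_) As → v ⊨ ⋁ As
    ⊨-⋁⁺ (here a)  = ⊨-∨⁺ (inj₁ a)
    ⊨-⋁⁺ (there p) = ⊨-∨⁺ (inj₂ (⊨-⋁⁺ p))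

    ⊨-⋁⁻ : ∀ {As} → v ⊨ ⋁ As → Any (v ⊨_) As
    ⊨-⋁⁻ {[]}     h = ⊥-elim (⊭⊥' h)
    ⊨-⋁⁻ {A ∷ As} h with ⊨-∨⁻ h
    ... | inj₁ a  = here a
    ... | inj₂ as = there (⊨-⋁⁻ as)

    ⊨-⋁¬⁺ : ∀ {X : Set} (f : X → Form m) xs →
            ¬ All (λ x → v ⊨ f x) xs → v ⊨ ⋁ (map (λ x → ¬' f x) xs)
    ⊨-⋁¬⁺ f xs ¬all = ⊨-⋁⁺ (Any.map⁺ (Any.map ⊨-¬⁺ (All.¬All⇒Any¬ (λ x → v ⊨? f x) xs ¬all)))

    ⊨-⋁¬⁻ : ∀ {X : Set} (f : X → Form m) xs →
            v ⊨ ⋁ (map (λ x → ¬' f x) xs) → ¬ All (λ x → v ⊨ f x) xs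
    ⊨-⋁¬⁻ f xs h = All.Any¬⇒¬All (Any.map ⊨-¬⁻ (Any.map⁻ (⊨-⋁⁻ h)))

  ⊢-tautological : ∀ {Ps : List (Form m)} {Q} → All ⊢_ Ps → (∀ v → All (v ⊨_) Ps → v ⊨ Q) → ⊢ Q
  ⊢-tautological []       h = ax (A0 (λ v → eval≡true (h v [])))
  ⊢-tautological (p ∷ ps) h =
    R1 (⊢-tautological ps (λ v vs → ⊨-⇒⁺ (λ vp → h v (vp ∷ vs)))) p

  ⇒-trans : ∀ {A B C : Form m} → ⊢ A ⇒ B → ⊢ B ⇒ C → ⊢ A ⇒ C
  ⇒-trans a⇒b b⇒c =
    ⊢-tautological (a⇒b ∷ b⇒c ∷ []) λ { v (f ∷ g ∷ []) → ⊨-⇒⁺ (⊨-⇒⁻ g ∘ ⊨-⇒⁻ f) }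

  K-mono : ∀ {A B : Form m} → ⊢ A ⇒ B → ⊢ K A ⇒ K B
  K-mono a⇒b = R1 (ax A7K) (R2 a⇒b)

  K⋀⇒⋀K : ∀ (As : List (Form m)) → ⊢ K (⋀ As) ⇒ ⋀ (map K_ As)
  K⋀⇒⋀K []       = ⊢-tautological [] λ v _ → ⊨-⇒⁺ λ _ → ⊨⊤'
  K⋀⇒⋀K (A ∷ As) =
    ⊢-tautological (K-mono ∧-proj₁ ∷ K-mono ∧-proj₂ ∷ K⋀⇒⋀K As ∷ [])
      λ { v (split₁ ∷ split₂ ∷ ih ∷ []) →
            ⊨-⇒⁺ λ k → ⊨-∧⁺ (⊨-⇒⁻ split₁ k) (⊨-⇒⁻ ih (⊨-⇒⁻ split₂ k)) }
    where
    ∧-proj₁ : ⊢ A ∧' ⋀ As ⇒ A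
    ∧-proj₁ = ⊢-tautological [] λ v _ → ⊨-⇒⁺ (proj₁ ∘ ⊨-∧⁻)
    ∧-proj₂ : ⊢ A ∧' ⋀ As ⇒ ⋀ As
    ∧-proj₂ = ⊢-tautological [] λ v _ → ⊨-⇒⁺ (proj₂ ∘ ⊨-∧⁻)

  ⋀K⇒K⋀ : ∀ (As : List (Form m)) → ⊢ ⋀ (map K_ As) ⇒ K (⋀ As)
  ⋀K⇒K⋀ []       =
    ⊢-tautological (R2 (⊢-tautological [] λ v _ → ⊨⊤') ∷ []) λ { v (K⊤ ∷ []) → ⊨-⇒⁺ λ _ → K⊤ }
  ⋀K⇒K⋀ (A ∷ As) =
    ⊢-tautological (K-mono ∧-pair ∷ ax A7K ∷ ⋀K⇒K⋀ As ∷ [])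
      λ { v (pair ∷ distrib ∷ ih ∷ []) →
            ⊨-⇒⁺ λ h → let kA , kAs = ⊨-∧⁻ h in
              ⊨-⇒⁻ (⊨-⇒⁻ distrib (⊨-⇒⁻ pair kA)) (⊨-⇒⁻ ih kAs) }
    where
    ∧-pair : ⊢ A ⇒ (⋀ As ⇒ A ∧' ⋀ As)
    ∧-pair = ⊢-tautological [] λ v _ → ⊨-⇒⁺ λ a → ⊨-⇒⁺ λ c → ⊨-∧⁺ a c

  -- Step Γ Γ′ holds exactly when Inherited Γ ⊆ Γ′.

  data Inherited (Γ : FSet {m}) : FSet {m} where
    known   : ∀ {A} → Γ (K A) → Inherited Γ (K A)
    evident : ∀ {t} → Γ (E t) → Inherited Γ (□ E t)

  record Decomposition (Γ : FSet {m}) (L : List (Form m)) : Set where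
    field
      As     : List (Form m)
      ts     : List Pol
      K-As∈Γ : All Γ (map K_ As)
      E-ts∈Γ : All Γ (map E_ ts)
      covers : ∀ {v} → All (λ A → v ⊨ K A) As → All (λ t → v ⊨ □ E t) ts → All (v ⊨_) L

  decompose : ∀ {Γ : FSet {m}} {L} → All (Inherited Γ) L → Decomposition Γ L
  decompose [] = record { As = [] ; ts = [] ; K-As∈Γ = [] ; E-ts∈Γ = [] ; covers = λ _ _ → [] }
  decompose (known {A} KA∈Γ ∷ rest) = record
    { As = A ∷ As ; ts = ts ; K-As∈Γ = KA∈Γ ∷ K-As∈Γ ; E-ts∈Γ = E-ts∈Γ
    ; covers = λ { (kA ∷ kAs) □Ets → kA ∷ covers kAs □Ets } }
    where open Decomposition (decompose rest)
  decompose (evident {t} Et∈Γ ∷ rest) = record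
    { As = As ; ts = t ∷ ts ; K-As∈Γ = K-As∈Γ ; E-ts∈Γ = Et∈Γ ∷ E-ts∈Γ
    ; covers = λ { kAs (□Et ∷ □Ets) → □Et ∷ covers kAs □Ets } }
    where open Decomposition (decompose rest)

  inherited-consistent : ∀ {Γ : FSet {m}} → Consistent Γ → Consistent (Inherited Γ)
  inherited-consistent Γ-consistent (L , L⊆ , ⊢¬L) =
    Γ-consistent (map K_ As ++ map E_ ts , All.++⁺ K-As∈Γ E-ts∈Γ , ⊢¬[KAs,Ets])
    where
    open Decomposition (decompose L⊆)

    ⊢⋀KAs⇒¬□Ets : ⊢ ⋀ (map K_ As) ⇒ ⋁ (map (λ t → ¬' □ E t) ts)
    ⊢⋀KAs⇒¬□Ets = ⊢-tautological (⊢¬L ∷ []) λ { v (¬L ∷ []) →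
      ⊨-⇒⁺ λ kAs → ⊨-⋁¬⁺ (λ t → □ E t) ts λ □Ets →
        ⊭⊥' (⊨-⇒⁻ ¬L (⊨-⋀⁺ (covers (All.map⁻ (⊨-⋀⁻ kAs)) □Ets))) }

    ⊢K⋀As⇒¬Ets : ⊢ K (⋀ As) ⇒ ⋁ (map (λ t → ¬' E t) ts)
    ⊢K⋀As⇒¬Ets = R4 ts (⇒-trans (K⋀⇒⋀K As) ⊢⋀KAs⇒¬□Ets)

    ⊢¬[KAs,Ets] : ⊢ ⋀ (map K_ As ++ map E_ ts) ⇒ ⊥'
    ⊢¬[KAs,Ets] = ⊢-tautological (⇒-trans (⋀K⇒K⋀ As) ⊢K⋀As⇒¬Ets ∷ []) λ { v (f ∷ []) →
      ⊨-⇒⁺ λ h → let kAs , Ets = All.++⁻ (map K_ As) (⊨-⋀⁻ h) in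
        ⊥-elim (⊨-⋁¬⁻ E_ ts (⊨-⇒⁻ f (⊨-⋀⁺ kAs)) (All.map⁻ Ets)) }

  Consistent-antimono : ∀ {Γ Δ : FSet {m}} → Γ ⊆ Δ → Consistent Δ → Consistent Γ
  Consistent-antimono Γ⊆Δ Δ-consistent (L , L⊆Γ , ⊢¬L) = Δ-consistent (L , All.map Γ⊆Δ L⊆Γ , ⊢¬L)

  -- Lindenbaum's lemma

  module Lindenbaum {B : FSet {m}} (B-consistent : Consistent B) where

    -- The condition is a proposition, not a decision, so the
    -- construction needs no decision procedure for consistency.
    stage : ℕ → FSet {m}
    stage zero    = B
    stage (suc k) = stage k ∪ λ A → code A ≡ k × Consistent (stage k ∪ ｛ A ｝)

    stage-mono : ∀ {k l} → k ≤ l → stage k ⊆ stage l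
    stage-mono = go ∘ ≤⇒≤′
      where
      go : ∀ {k l} → k ≤′ l → stage k ⊆ stage l
      go ≤′-refl     A∈ = A∈
      go (≤′-step p) A∈ = inj₁ (go p A∈)

    stage-suc-⊆ : ∀ {k A} → code A ≡ k → stage (suc k) ⊆ stage k ∪ ｛ A ｝
    stage-suc-⊆ _       (inj₁ X∈)                = inj₁ X∈
    stage-suc-⊆ codeA≡k (inj₂ (codeX≡k , _)) =
      inj₂ (code-injective (trans codeA≡k (sym codeX≡k)))

    stage-consistent : ∀ k → Consistent (stage k)
    stage-consistent zero = B-consistent
    stage-consistent (suc k) (L , L⊆ , ⊢¬L) with All∪⇒All⊎Any L⊆
    ... | inj₁ L⊆stage = stage-consistent k (L , L⊆stage , ⊢¬L)
    ... | inj₂ some-new =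
      let A , codeA≡k , A-consistent = satisfied some-new in
      Consistent-antimono (stage-suc-⊆ codeA≡k) A-consistent (L , L⊆ , ⊢¬L)

    limit : FSet {m}
    limit = ⋃ ℕ stage

    finite-⊆-stage : ∀ {L} → All limit L → ∃ λ k → All (stage k) L
    finite-⊆-stage [] = 0 , []
    finite-⊆-stage ((k , A∈) ∷ rest) =
      let l , rest⊆ = finite-⊆-stage rest in
      k ⊔ l , stage-mono (m≤m⊔n k l) A∈ ∷ All.map (stage-mono (m≤n⊔m k l)) rest⊆

    limit-maxiconsistent : Maxiconsistent limit
    limit-maxiconsistent = consistent , maximal
      where
      consistent : Consistent limit
      consistent (L , L⊆ , ⊢¬L) =
        let k , L⊆stage = finite-⊆-stage L⊆ in stage-consistent k (L , L⊆stage , ⊢¬L)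

      maximal : ∀ Δ → ProperExt limit Δ → ¬ Consistent Δ
      maximal Δ (limit⊆Δ , A , A∈Δ , A∉limit) Δ-consistent =
        A∉limit (suc (code A) , inj₂ (refl , Consistent-antimono stage∪A⊆Δ Δ-consistent))
        where
        stage∪A⊆Δ : stage (code A) ∪ ｛ A ｝ ⊆ Δ
        stage∪A⊆Δ (inj₁ X∈)   = limit⊆Δ (code A , X∈)
        stage∪A⊆Δ (inj₂ refl) = A∈Δ

  lindenbaum : ∀ {B : FSet {m}} → Consistent B → Σ[ Γ ∈ FSet {m} ] (B ⊆ Γ × Maxiconsistent Γ)
  lindenbaum B-consistent = limit , (λ B∋A → 0 , B∋A) , limit-maxiconsistent
    where open Lindenbaum B-consistent

  successor : ∀ {Γ : FSet {m}} → Consistent Γ → Σ[ Γ′ ∈ FSet {m} ] (Maxiconsistent Γ′ × Step Γ Γ′)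
  successor Γ-consistent =
    let Γ′ , inherited⊆Γ′ , Γ′-maxiconsistent = lindenbaum (inherited-consistent Γ-consistent) in
    Γ′ , Γ′-maxiconsistent , (λ _ → inherited⊆Γ′ ∘ known) , (λ _ → inherited⊆Γ′ ∘ evident)

successor-of-last : ∀ {m} {Γs : List (FSet {m})} → 1 ≤ length Γs → All Maxiconsistent Γs →
                    Σ[ Γ ∈ FSet {m} ] (Maxiconsistent Γ × Connected Step (last Γs) (just Γ))
successor-of-last {Γs = Γs} nonempty maxiconsistent
  with last Γs | last-satisfies nonempty maxiconsistent
... | nothing | ()
... | just Γₙ | MaybeAny.just Γₙ-maxiconsistent =
  let Γ , Γ-maxiconsistent , Γₙ↝Γ = successor (proj₁ Γₙ-maxiconsistent) in
  Γ , Γ-maxiconsistent , just Γₙ↝Γ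

lemma3 : (m : ℕ) (Γs : List (FSet {m})) → Element Γs →
         Σ (FSet {m}) (λ Γ → Element (Γs ++ [ Γ ]))
lemma3 m Γs (nonempty , maxiconsistent , linked) =
  let Γ , Γ-maxiconsistent , Γₙ↝Γ = successor-of-last nonempty maxiconsistent in
  Γ , ≤-trans nonempty (length-++-≤ˡ Γs)
    , All.++⁺ maxiconsistent (Γ-maxiconsistent ∷ [])
    , Linked.++⁺ linked Γₙ↝Γ [-]
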